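{- Let $N=\{1,\ldots,n\}$ and let $\mathcal{F}\subseteq 2^N$ be intersection-closed. Let $1\le i\le n$ and let $A$ be a discarding set at level $i$, i.e. $A\subseteq [i-1]$, $A\in\mathcal{F}$ and $A\cup\{i\}\notin\mathcal{F}$. Then all sets $X\subseteq\{i+1,\ldots,n\}$ with $A\cup\{i\}\cup X\in\mathcal{F}$ have a common element $j$ with $j>i$; that is, if there is at least one such $X$, then $\bigcap\{X\subseteq\{i+1,\ldots,n\} : A\cup\{i\}\cup X\in\mathcal{F}\}\neq\varnothing$.
   Context: A family $\mathcal{F}\subseteq 2^N$ is intersection-closed if $A\cap B\in\mathcal{F}$ for all $A,B\in\mathcal{F}$. For an integer $i$, $[i]=\{1,\ldots,i\}$ (so $[0]=\varnothing$). -}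

module Defs where

open import Data.Nat using (ℕ; suc; _<_)
open import Data.Fin using (Fin; toℕ)
open import Data.Fin.Subset using (Subset; _∩_; _∪_; _⊆_; _∈_; _∉_; ⁅_⁆)
open import Data.Product using (_×_; Σ; ∃-syntax)
open import Relation.Nullary using (¬_; Dec)

-- Ground set N = {1,…,n} is represented by Fin n; the element k : Fin n
-- stands for the number toℕ k + 1.  A subset of N is a Subset n.

Family : ℕ → Set₁
Family n = Subset n → Set

IntersectionClosed : ∀ {n} → Family n → Set
IntersectionClosed F = ∀ A B → F A → F B → F (A ∩ B)

num : ∀ {n} → Fin n → ℕ
num k = suc (toℕ k)

SubsetOfInitial : ∀ {n} → ℕ → Subset n → Set
SubsetOfInitial m A = ∀ k → k ∈ A → num k Data.Nat.≤ m

SubsetAbove : ∀ {n} → ℕ → Subset n → Set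
SubsetAbove m X = ∀ k → k ∈ X → m < num k

Discarding : ∀ {n} → Family n → Fin n → Subset n → Set
Discarding F i A =
  SubsetOfInitial (toℕ i) A × F A × ¬ F (A ∪ ⁅ i ⁆)

Admissible : ∀ {n} → Family n → Fin n → Subset n → Subset n → Set
Admissible F i A X = SubsetAbove (num i) X × F ((A ∪ ⁅ i ⁆) ∪ X)

{-# OPTIONS --safe #-}
-- Sets X ⊆ {i+1,…,n} with A ∪ {i} ∪ X ∈ F form an intersection-closed family,
-- since (A ∪ {i}) ∪ (X ∩ Y) = ((A ∪ {i}) ∪ X) ∩ ((A ∪ {i}) ∪ Y).  Being finite
-- and inhabited, it has a least member Z, contained in every member.  Z cannot
-- be empty, for then A ∪ {i} = (A ∪ {i}) ∪ Z ∈ F; any j ∈ Z is the common element.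
module Submission where

open import Defs
open import Data.Nat using (ℕ; _<_)
open import Data.Nat.Properties using (_<?_)
open import Data.Fin using (Fin)
open import Data.Fin.Properties using (all?)
open import Data.Fin.Subset using (Subset; _∈_; _∩_; _∪_; _⊆_; ⁅_⁆; Nonempty)
open import Data.Fin.Subset.Properties
  using (_∈?_; anySubset?; nonempty?; x∈p∩q⁻; Empty-unique; ∪-identityʳ; ∪-distribˡ-∩)
open import Data.List using (foldr; tabulate)
open import Data.List.Properties using (foldr-preservesᵇ; foldr-forcesᵇ)
open import Data.List.Relation.Unary.All.Properties using (tabulate⁺; tabulate⁻)
open import Data.Product using (_×_; ∃-syntax; _,_; proj₁; proj₂)
open import Relation.Nullary using (Dec; yes; no; ¬_; ¬?; contradiction)
open import Relation.Nullary.Decidable using (_→-dec_; _×-dec_; decidable-stable)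
open import Relation.Unary using (Decidable)
open import Relation.Binary.PropositionalEquality using (subst; cong; trans; sym)

module _ {n : ℕ} {P : Family n} (P? : Decidable P) (P-∩ : IntersectionClosed P) where

  member-omitting-if-any : (X₀ : Subset n) → P X₀ → (k : Fin n) →
                           ∃[ Y ] P Y × (k ∈ Y → ∀ Y′ → P Y′ → k ∈ Y′)
  member-omitting-if-any X₀ PX₀ k with anySubset? (λ Y → P? Y ×-dec ¬? (k ∈? Y))
  ... | yes (Y , PY , k∉Y) = Y , PY , λ k∈Y → contradiction k∈Y k∉Y
  ... | no ∄omitting = X₀ , PX₀ , λ _ Y′ PY′ →
    decidable-stable (k ∈? Y′) (λ k∉Y′ → ∄omitting (Y′ , PY′ , k∉Y′))

  least-member : ∃[ X ] P X → ∃[ Z ] P Z × (∀ Y → P Y → Z ⊆ Y)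
  least-member (X₀ , PX₀) = Z , PZ , Z-least
    where
    omitting : ∀ k → ∃[ Y ] P Y × (k ∈ Y → ∀ Y′ → P Y′ → k ∈ Y′)
    omitting = member-omitting-if-any X₀ PX₀

    W : Fin n → Subset n
    W k = proj₁ (omitting k)

    Z : Subset n
    Z = foldr _∩_ X₀ (tabulate W)

    PZ : P Z
    PZ = foldr-preservesᵇ {P = P} (P-∩ _ _) PX₀
           (tabulate⁺ (λ k → proj₁ (proj₂ (omitting k))))

    Z⊆W : ∀ {k} → k ∈ Z → k ∈ W k
    Z⊆W {k} k∈Z = tabulate⁻ (foldr-forcesᵇ x∈p∩q⁻ X₀ (tabulate W) k∈Z) k

    Z-least : ∀ Y → P Y → Z ⊆ Y
    Z-least Y PY k∈Z = proj₂ (proj₂ (omitting _)) (Z⊆W k∈Z) Y PY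

¬P[p]⇒P[p∪q]⇒Nonempty[q] : ∀ {n} {P : Family n} {p q : Subset n} →
                           ¬ P p → P (p ∪ q) → Nonempty q
¬P[p]⇒P[p∪q]⇒Nonempty[q] {P = P} {p} {q} ¬Pp Pp∪q =
  decidable-stable (nonempty? q) λ q-empty →
    ¬Pp (subst P (trans (cong (p ∪_) (Empty-unique q-empty)) (∪-identityʳ p)) Pp∪q)

module _ {n : ℕ} {F : Family n} (i : Fin n) (A : Subset n) where

  admissible? : Decidable F → Decidable (Admissible F i A)
  admissible? F? X = all? (λ k → (k ∈? X) →-dec (num i <? num k)) ×-dec F? ((A ∪ ⁅ i ⁆) ∪ X)

  admissible-∩-closed : IntersectionClosed F → IntersectionClosed (Admissible F i A)
  admissible-∩-closed F-∩ X Y (X-above , FX) (_ , FY) =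
    (λ k k∈X∩Y → X-above k (proj₁ (x∈p∩q⁻ X Y k∈X∩Y))) ,
    subst F (sym (∪-distribˡ-∩ (A ∪ ⁅ i ⁆) X Y)) (F-∩ _ _ FX FY)

lemma1 : (n : ℕ) (F : Family n) → (∀ S → Dec (F S)) → IntersectionClosed F →
         (i : Fin n) (A : Subset n) → Discarding F i A →
         ∃[ X ] Admissible F i A X →
         ∃[ j ] (num i < num j × (∀ X → Admissible F i A X → j ∈ X))
lemma1 n F F? F-∩ i A (_ , _ , A∪i∉F) admissible-exists
  with least-member (admissible? i A F?) (admissible-∩-closed i A F-∩) admissible-exists
... | Z , (Z-above , FA∪i∪Z) , Z-least
  with ¬P[p]⇒P[p∪q]⇒Nonempty[q] {P = F} A∪i∉F FA∪i∪Z
... | j , j∈Z = j , Z-above j j∈Z , λ X admissible-X → Z-least X admissible-X j∈Z
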